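{- Let $\mu$ be a lattice path (a word in $\{U,D\}$) whose first step is $U$ and whose last step is $D$, and let $\overline{\mu}$ be its dual path. Then $M(\mu)=M(\overline{\mu})$, where $M(\cdot)$ is the maximal right label defined in the context.
   Context: Lattice paths use up steps $U=(0,1)$ and right steps $D=(1,0)$. The dual of $\mu=\mu_1\cdots\mu_m$ is $\overline{\mu}=\overline{\mu_m}\,\overline{\mu_{m-1}}\cdots\overline{\mu_1}$, where $\overline{U}=D$ and $\overline{D}=U$. Let $N(U)$ and $N(D)$ be the numbers of up and right steps of $\mu$. For $0\le i\le N(D)-1$, let $h(i)$ be the height of the right step of $\mu$ going from $(i,h(i))$ to $(i+1,h(i))$. Put $s'_i=N(U)+1-h(i)$. A sequence $(s_0,\dots,s_{N(D)-1})$ is obtained from $(s'_i)$ by the following algorithm: 1. Set $i=N(D)-2$. 2. If $s'_i=s'_{i+1}$, increase all current entries $s'_{j}$ with $j\le i$ by one; if $s'_i\ne s'_{i+1}$, do nothing. 3. If $i\neq 0$, decrease $i$ by one and go to step 2. Otherwise stop. The final values are $s_i$, the label of the point $(i,0)$. Right labels $y(j)$, $1\le j\le N(U)$, are assigned to the points $(N(D),j)$. If $\mu$ has a peak (an occurrence $UD$) whose $U$ ends at the point $(i,j)$, then $y(j)=s_i+1$. For a height $j$ at which $\mu$ has no peak, $y(j)=1+y(j+1)$. Since $\mu$ ends with $D$, height $N(U)$ carries a peak, so this recursion is well defined. Finally, $M(\mu):=\max_j y(j)$. -}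

module Defs where

open import Data.Nat using (ℕ; zero; suc; _+_; _∸_; _⊔_; _≡ᵇ_; _≤ᵇ_)
open import Data.Bool using (Bool; true; false; if_then_else_)
open import Data.List using (List; []; _∷_; map; foldr; reverse; upTo; length)
open import Data.Maybe using (Maybe; just; nothing)
open import Data.Product using (_×_; _,_)

-- Steps: U = (0,1) up step, D = (1,0) right step.
data Step : Set where
  U D : Step

dualStep : Step → Step
dualStep U = D
dualStep D = U

dual : List Step → List Step
dual μ = reverse (map dualStep μ)

NU : List Step → ℕ
NU [] = 0
NU (U ∷ μ) = suc (NU μ)
NU (D ∷ μ) = NU μ

ND : List Step → ℕ
ND [] = 0
ND (U ∷ μ) = ND μ
ND (D ∷ μ) = suc (ND μ)

heightsFrom : ℕ → List Step → List ℕ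
heightsFrom j [] = []
heightsFrom j (U ∷ μ) = heightsFrom (suc j) μ
heightsFrom j (D ∷ μ) = j ∷ heightsFrom j μ

heights : List Step → List ℕ
heights = heightsFrom 0

-- list lookup with default 0 (only used at valid indices)
at : List ℕ → ℕ → ℕ
at [] _ = 0
at (x ∷ xs) zero = x
at (x ∷ xs) (suc i) = at xs i

h : List Step → ℕ → ℕ
h μ = at (heights μ)

s′ : List Step → ℕ → ℕ
s′ μ i = suc (NU μ) ∸ h μ i

-- Step 2 of the algorithm at index i, acting on the current entries f:
-- if f i = f (i+1), increase all entries with index j ≤ i by one.
algStep : ℕ → (ℕ → ℕ) → (ℕ → ℕ)
algStep i f with f i ≡ᵇ f (suc i)
... | true  = λ j → if j ≤ᵇ i then suc (f j) else f j
... | false = f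

runFrom : ℕ → (ℕ → ℕ) → (ℕ → ℕ)
runFrom zero f = algStep zero f
runFrom (suc i) f = runFrom i (algStep (suc i) f)

-- the algorithm starts at i = N(D) - 2; if N(D) < 2 there is nothing to do
algorithm : ℕ → (ℕ → ℕ) → (ℕ → ℕ)
algorithm (suc (suc k)) f = runFrom k f
algorithm _ f = f

-- s_i, the label of the point (i,0)
s : List Step → ℕ → ℕ
s μ = algorithm (ND μ) (s′ μ)

-- peaks: pairs (i , j) such that an occurrence UD has its U ending at (i , j)
-- (arguments: current point (i , j))
peaksFrom : ℕ → ℕ → List Step → List (ℕ × ℕ)
peaksFrom i j [] = []
peaksFrom i j (U ∷ []) = []
peaksFrom i j (U ∷ U ∷ μ) = peaksFrom i (suc j) (U ∷ μ)
peaksFrom i j (U ∷ D ∷ μ) = (i , suc j) ∷ peaksFrom i (suc j) (D ∷ μ)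
peaksFrom i j (D ∷ μ) = peaksFrom (suc i) j μ

peaks : List Step → List (ℕ × ℕ)
peaks = peaksFrom 0 0

peakAtHeight : List (ℕ × ℕ) → ℕ → Maybe ℕ
peakAtHeight [] j = nothing
peakAtHeight ((i , j′) ∷ ps) j = if j′ ≡ᵇ j then just i else peakAtHeight ps j

-- Recursion on d = N(U) - j.
-- (The 'nothing' case at d = 0, i.e. j = N(U), does not occur when μ ends with D.)
yFrom : List Step → ℕ → ℕ → ℕ
yFrom μ j d with peakAtHeight (peaks μ) j
yFrom μ j d       | just i  = suc (s μ i)
yFrom μ j zero    | nothing = 1
yFrom μ j (suc d) | nothing = suc (yFrom μ (suc j) d)

y : List Step → ℕ → ℕ
y μ j = yFrom μ j (NU μ ∸ j)

M : List Step → ℕ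
M μ = foldr _⊔_ 0 (map (λ k → y μ (suc k)) (upTo (NU μ)))

{-# OPTIONS --safe #-}
-- Step 2 at a plateau s'_m = s'_(m+1) adds one to all entries of index ≤ m,
-- which leaves the comparisons further left unchanged; so s_i is s'_i plus the
-- number of plateaus at m ≥ i, and as s' is N(U) + 1 − h, the plateaus are
-- exactly the factors DD of μ.  Heights never decrease, so the
-- lowest peak is the first right step and no peak lies below it; descending
-- from it gives y(1) = N(U) + 1 + #DD, and every other label is at most this.
-- As μ ends with D, N(D) = 1 + #DD + #DU, hence M(μ) = |μ| − #DU.  Duality
-- preserves the length and maps factors DU to factors DU.
module Submission where

open import Defs
open import Data.List using (List; head; last)
open import Data.Maybe using (just)
open import Relation.Binary.PropositionalEquality using (_≡_)

open import Data.Bool using (true; false; if_then_else_)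
open import Data.Bool.Properties using (T-≡; if-cong; if-cong-then)
open import Data.Empty using (⊥-elim)
open import Data.List using ([]; _∷_; map; foldr; reverse; length; _∷ʳ_; applyUpTo)
open import Data.List.Properties using (unfold-reverse; length-reverse; length-map; head-map; last-map; reverse-involutive; foldr-preservesᵇ)
open import Data.List.Relation.Unary.All as All using (All; []; _∷_; universal)
open import Data.List.Relation.Unary.All.Properties using (map⁺)
open import Data.List.Relation.Unary.AllPairs using (AllPairs; []; _∷_)
open import Data.Maybe using (Maybe; nothing)
import Data.Maybe as Maybe
open import Data.Nat using (ℕ; zero; suc; _+_; _∸_; _⊔_; _≡ᵇ_; _≤ᵇ_; _≤_; _<_; z≤n; s≤s; pred)
open import Data.Nat.Properties
open import Algebra.Properties.CommutativeSemigroup +-commutativeSemigroup using (x∙yz≈y∙xz)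
open import Data.Product using (_×_; _,_; ∃-syntax)
open import Function using (_∘_; flip)
open import Function.Bundles using (Equivalence)
open import Relation.Binary.PropositionalEquality using (_≢_; refl; sym; trans; cong; cong₂; subst; module ≡-Reasoning)
open import Relation.Nullary.Decidable using (dec-true; dec-false; does-≡; map′)

private
  variable
    A B : Set

≡ᵇ-refl : ∀ n → (n ≡ᵇ n) ≡ true
≡ᵇ-refl n = dec-true (n ≟ n) refl

≢⇒≡ᵇ-false : ∀ {m n} → m ≢ n → (m ≡ᵇ n) ≡ false
≢⇒≡ᵇ-false {m} {n} = dec-false (m ≟ n)

≡ᵇ-true⇒≡ : ∀ {m n} → (m ≡ᵇ n) ≡ true → m ≡ n
≡ᵇ-true⇒≡ {m} {n} = ≡ᵇ⇒≡ m n ∘ Equivalence.from T-≡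

δ : ℕ → ℕ → ℕ
δ m n = if m ≡ᵇ n then 1 else 0

δ-refl : ∀ n → δ n n ≡ 1
δ-refl n = cong (if_then 1 else 0) (≡ᵇ-refl n)

δ-≢ : ∀ {m n} → m ≢ n → δ m n ≡ 0
δ-≢ m≢n = cong (if_then 1 else 0) (≢⇒≡ᵇ-false m≢n)

δ-cong : ∀ {m n m′ n′} → (m ≡ n → m′ ≡ n′) → (m′ ≡ n′ → m ≡ n) → δ m n ≡ δ m′ n′
δ-cong {m} {n} {m′} {n′} to from = cong (if_then 1 else 0) (does-≡ (m ≟ n) (map′ from to (m′ ≟ n′)))

adjacentSum : (A → A → ℕ) → List A → ℕ
adjacentSum p (x ∷ y ∷ xs) = p x y + adjacentSum p (y ∷ xs)
adjacentSum p _            = 0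

adjacentSum-cong : ∀ {p q : A → A → ℕ} → (∀ x y → p x y ≡ q x y) →
                   ∀ xs → adjacentSum p xs ≡ adjacentSum q xs
adjacentSum-cong p≗q []           = refl
adjacentSum-cong p≗q (x ∷ [])     = refl
adjacentSum-cong p≗q (x ∷ y ∷ xs) = cong₂ _+_ (p≗q x y) (adjacentSum-cong p≗q (y ∷ xs))

adjacentSum-map : ∀ (p : B → B → ℕ) (f : A → B) xs →
                  adjacentSum p (map f xs) ≡ adjacentSum (λ x y → p (f x) (f y)) xs
adjacentSum-map p f []           = refl
adjacentSum-map p f (x ∷ [])     = refl
adjacentSum-map p f (x ∷ y ∷ xs) = cong (p (f x) (f y) +_) (adjacentSum-map p f (y ∷ xs))

adjacentSum-∷ʳ : ∀ (p : A → A → ℕ) xs y z → adjacentSum p (xs ∷ʳ y ∷ʳ z) ≡ adjacentSum p (xs ∷ʳ y) + p y z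
adjacentSum-∷ʳ p []           y z = +-comm (p y z) 0
adjacentSum-∷ʳ p (x ∷ [])     y z =
  trans (cong (p x y +_) (adjacentSum-∷ʳ p [] y z)) (sym (+-assoc (p x y) _ (p y z)))
adjacentSum-∷ʳ p (x ∷ w ∷ xs) y z =
  trans (cong (p x w +_) (adjacentSum-∷ʳ p (w ∷ xs) y z)) (sym (+-assoc (p x w) _ (p y z)))

adjacentSum-reverse : ∀ (p : A → A → ℕ) xs → adjacentSum p (reverse xs) ≡ adjacentSum (flip p) xs
adjacentSum-reverse p []           = refl
adjacentSum-reverse p (x ∷ [])     = refl
adjacentSum-reverse p (x ∷ y ∷ xs) = begin
  adjacentSum p (reverse (x ∷ y ∷ xs))
    ≡⟨ cong (adjacentSum p) (trans (unfold-reverse x (y ∷ xs)) (cong (_∷ʳ x) (unfold-reverse y xs))) ⟩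
  adjacentSum p (reverse xs ∷ʳ y ∷ʳ x)
    ≡⟨ adjacentSum-∷ʳ p (reverse xs) y x ⟩
  adjacentSum p (reverse xs ∷ʳ y) + p y x
    ≡⟨ cong (λ ys → adjacentSum p ys + p y x) (unfold-reverse y xs) ⟨
  adjacentSum p (reverse (y ∷ xs)) + p y x
    ≡⟨ cong (_+ p y x) (adjacentSum-reverse p (y ∷ xs)) ⟩
  adjacentSum (flip p) (y ∷ xs) + p y x
    ≡⟨ +-comm _ (p y x) ⟩
  adjacentSum (flip p) (x ∷ y ∷ xs)
    ∎
  where open ≡-Reasoning

last-∷ʳ : ∀ (xs : List A) x → last (xs ∷ʳ x) ≡ just x
last-∷ʳ []           x = refl
last-∷ʳ (_ ∷ [])     x = refl
last-∷ʳ (_ ∷ y ∷ xs) x = last-∷ʳ (y ∷ xs) x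

last-reverse : ∀ (xs : List A) → last (reverse xs) ≡ head xs
last-reverse []       = refl
last-reverse (x ∷ xs) = trans (cong last (unfold-reverse x xs)) (last-∷ʳ (reverse xs) x)

head-reverse : ∀ (xs : List A) → head (reverse xs) ≡ last xs
head-reverse xs = trans (sym (last-reverse (reverse xs))) (cong last (reverse-involutive xs))

isDD isDU : Step → Step → ℕ
isDD D D = 1
isDD _ _ = 0
isDU D U = 1
isDU _ _ = 0

countDD countDU : List Step → ℕ
countDD = adjacentSum isDD
countDU = adjacentSum isDU

countDD-U∷ : ∀ μ → countDD (U ∷ μ) ≡ countDD μ
countDD-U∷ []      = refl
countDD-U∷ (_ ∷ _) = refl

NU+ND≡length : ∀ μ → NU μ + ND μ ≡ length μ
NU+ND≡length []      = refl
NU+ND≡length (U ∷ μ) = cong suc (NU+ND≡length μ)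
NU+ND≡length (D ∷ μ) = trans (+-suc (NU μ) (ND μ)) (cong suc (NU+ND≡length μ))

ND≡1+countDD+countDU : ∀ μ → last μ ≡ just D → ND μ ≡ suc (countDD μ + countDU μ)
ND≡1+countDD+countDU (D ∷ [])    _     = refl
ND≡1+countDD+countDU (U ∷ x ∷ μ) lastD = ND≡1+countDD+countDU (x ∷ μ) lastD
ND≡1+countDD+countDU (D ∷ D ∷ μ) lastD = cong suc (ND≡1+countDD+countDU (D ∷ μ) lastD)
ND≡1+countDD+countDU (D ∷ U ∷ μ) lastD = cong suc (begin
  ND (U ∷ μ)                                   ≡⟨ ND≡1+countDD+countDU (U ∷ μ) lastD ⟩
  suc (countDD (U ∷ μ) + countDU (U ∷ μ))      ≡⟨ +-suc (countDD (U ∷ μ)) (countDU (U ∷ μ)) ⟨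
  countDD (U ∷ μ) + suc (countDU (U ∷ μ))      ∎)
  where open ≡-Reasoning

isDU-dual : ∀ x y → isDU (dualStep y) (dualStep x) ≡ isDU x y
isDU-dual U U = refl
isDU-dual U D = refl
isDU-dual D U = refl
isDU-dual D D = refl

countDU-dual : ∀ μ → countDU (dual μ) ≡ countDU μ
countDU-dual μ = begin
  adjacentSum isDU (reverse (map dualStep μ))              ≡⟨ adjacentSum-reverse isDU (map dualStep μ) ⟩
  adjacentSum (flip isDU) (map dualStep μ)                 ≡⟨ adjacentSum-map (flip isDU) dualStep μ ⟩
  adjacentSum (λ x y → isDU (dualStep y) (dualStep x)) μ   ≡⟨ adjacentSum-cong isDU-dual μ ⟩
  countDU μ                                                ∎
  where open ≡-Reasoning

head-dual : ∀ μ → head (dual μ) ≡ Maybe.map dualStep (last μ)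
head-dual μ = trans (head-reverse (map dualStep μ)) (last-map dualStep μ)

last-dual : ∀ μ → last (dual μ) ≡ Maybe.map dualStep (head μ)
last-dual μ = trans (last-reverse (map dualStep μ)) (head-map μ)

length-dual : ∀ μ → length (dual μ) ≡ length μ
length-dual μ = trans (length-reverse (map dualStep μ)) (length-map dualStep μ)

-- The algorithm in closed form

plateausFrom : (ℕ → ℕ) → ℕ → ℕ → ℕ
plateausFrom f i zero    = 0
plateausFrom f i (suc n) = (if i ≤ᵇ n then δ (f n) (f (suc n)) else 0) + plateausFrom f i n

plateausFrom-cong : ∀ {f g} i n → (∀ {m} → m < n → δ (g m) (g (suc m)) ≡ δ (f m) (f (suc m))) →
                    plateausFrom g i n ≡ plateausFrom f i n
plateausFrom-cong i zero    g≗f = refl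
plateausFrom-cong i (suc n) g≗f =
  cong₂ _+_ (if-cong-then (i ≤ᵇ n) (g≗f ≤-refl)) (plateausFrom-cong i n (g≗f ∘ m<n⇒m<1+n))

plateausFrom-≤ : ∀ f i n → plateausFrom f i n ≤ plateausFrom f 0 n
plateausFrom-≤ f i zero    = z≤n
plateausFrom-≤ f i (suc n) with i ≤ᵇ n
... | true  = +-monoʳ-≤ (δ (f n) (f (suc n))) (plateausFrom-≤ f i n)
... | false = ≤-trans (plateausFrom-≤ f i n) (m≤n+m _ _)

plateausFrom-suc : ∀ f n → plateausFrom f 0 (suc n) ≡ δ (f 0) (f 1) + plateausFrom (f ∘ suc) 0 n
plateausFrom-suc f zero    = refl
plateausFrom-suc f (suc n) =
  trans (cong (δ (f (suc n)) (f (suc (suc n))) +_) (plateausFrom-suc f n))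
        (x∙yz≈y∙xz (δ (f (suc n)) (f (suc (suc n)))) (δ (f 0) (f 1)) _)

algStep-≡ : ∀ i f j → algStep i f j ≡ f j + (if j ≤ᵇ i then δ (f i) (f (suc i)) else 0)
algStep-≡ i f j with f i ≡ᵇ f (suc i)
... | true  with j ≤ᵇ i
...   | true  = +-comm 1 (f j)
...   | false = sym (+-identityʳ (f j))
algStep-≡ i f j | false with j ≤ᵇ i
...   | true  = sym (+-identityʳ (f j))
...   | false = sym (+-identityʳ (f j))

algStep-≤ : ∀ {i j} f → j ≤ i → algStep i f j ≡ f j + δ (f i) (f (suc i))
algStep-≤ {i} {j} f j≤i =
  trans (algStep-≡ i f j) (cong (f j +_) (if-cong {x = δ (f i) (f (suc i))} {y = 0} (dec-true (j ≤? i) j≤i)))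

plateau-algStep : ∀ {i m} f → m < i →
                  δ (algStep i f m) (algStep i f (suc m)) ≡ δ (f m) (f (suc m))
plateau-algStep {i} {m} f m<i = begin
  δ (algStep i f m) (algStep i f (suc m)) ≡⟨ cong₂ δ (algStep-≤ f (<⇒≤ m<i)) (algStep-≤ f m<i) ⟩
  δ (f m + c) (f (suc m) + c)             ≡⟨ δ-cong (+-cancelʳ-≡ c (f m) (f (suc m))) (cong (_+ c)) ⟩
  δ (f m) (f (suc m))                     ∎
  where
  open ≡-Reasoning
  c = δ (f i) (f (suc i))

runFrom-≡ : ∀ k f j → runFrom k f j ≡ f j + plateausFrom f j (suc k)
runFrom-≡ zero    f j = trans (algStep-≡ 0 f j) (cong (f j +_) (sym (+-identityʳ _)))
runFrom-≡ (suc k) f j = begin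
  runFrom k g j                             ≡⟨ runFrom-≡ k g j ⟩
  g j + plateausFrom g j (suc k)            ≡⟨ cong₂ _+_ (algStep-≡ (suc k) f j)
                                                         (plateausFrom-cong j (suc k) (plateau-algStep f)) ⟩
  f j + b + plateausFrom f j (suc k)        ≡⟨ +-assoc (f j) b _ ⟩
  f j + plateausFrom f j (suc (suc k))      ∎
  where
  open ≡-Reasoning
  g = algStep (suc k) f
  b = if j ≤ᵇ suc k then δ (f (suc k)) (f (suc (suc k))) else 0

algorithm-≡ : ∀ n f j → algorithm n f j ≡ f j + plateausFrom f j (n ∸ 1)
algorithm-≡ zero          f j = sym (+-identityʳ (f j))
algorithm-≡ (suc zero)    f j = sym (+-identityʳ (f j))
algorithm-≡ (suc (suc k)) f j = runFrom-≡ k f j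

heightsFrom-≥ : ∀ c μ → All (c ≤_) (heightsFrom c μ)
heightsFrom-≥ c []      = []
heightsFrom-≥ c (U ∷ μ) = All.map (≤-trans (n≤1+n c)) (heightsFrom-≥ (suc c) μ)
heightsFrom-≥ c (D ∷ μ) = ≤-refl ∷ heightsFrom-≥ c μ

heightsFrom-≤ : ∀ c μ → All (_≤ c + NU μ) (heightsFrom c μ)
heightsFrom-≤ c []      = []
heightsFrom-≤ c (U ∷ μ) = All.map (λ p → ≤-trans p (≤-reflexive (sym (+-suc c (NU μ))))) (heightsFrom-≤ (suc c) μ)
heightsFrom-≤ c (D ∷ μ) = m≤m+n c (NU μ) ∷ heightsFrom-≤ c μ

heightsFrom-nondecreasing : ∀ c μ → AllPairs _≤_ (heightsFrom c μ)
heightsFrom-nondecreasing c []      = []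
heightsFrom-nondecreasing c (U ∷ μ) = heightsFrom-nondecreasing (suc c) μ
heightsFrom-nondecreasing c (D ∷ μ) = heightsFrom-≥ c μ ∷ heightsFrom-nondecreasing c μ

length-heightsFrom : ∀ c μ → length (heightsFrom c μ) ≡ ND μ
length-heightsFrom c []      = refl
length-heightsFrom c (U ∷ μ) = length-heightsFrom (suc c) μ
length-heightsFrom c (D ∷ μ) = cong suc (length-heightsFrom c μ)

-- `at` returns 0 outside the list, so the bound holds at every index.
at-≤ : ∀ {b xs} → All (_≤ b) xs → ∀ i → at xs i ≤ b
at-≤ []         i       = z≤n
at-≤ (x≤b ∷ _)  zero    = x≤b
at-≤ (_ ∷ xs≤b) (suc i) = at-≤ xs≤b i

adjacentSum-δ-< : ∀ {x xs} → All (x <_) xs → adjacentSum δ (x ∷ xs) ≡ adjacentSum δ xs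
adjacentSum-δ-< []           = refl
adjacentSum-δ-< (x<y ∷ x<ys) = cong (_+ _) (δ-≢ (<⇒≢ x<y))

adjacentSum-δ-heightsFrom : ∀ c μ → adjacentSum δ (heightsFrom c μ) ≡ countDD μ
adjacentSum-δ-heightsFrom c []          = refl
adjacentSum-δ-heightsFrom c (U ∷ μ)     = trans (adjacentSum-δ-heightsFrom (suc c) μ) (sym (countDD-U∷ μ))
adjacentSum-δ-heightsFrom c (D ∷ [])    = refl
adjacentSum-δ-heightsFrom c (D ∷ D ∷ μ) = cong₂ _+_ (δ-refl c) (adjacentSum-δ-heightsFrom c (D ∷ μ))
adjacentSum-δ-heightsFrom c (D ∷ U ∷ μ) =
  trans (adjacentSum-δ-< (heightsFrom-≥ (suc c) μ)) (adjacentSum-δ-heightsFrom c (U ∷ μ))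

plateausFrom-at : ∀ xs → plateausFrom (at xs) 0 (length xs ∸ 1) ≡ adjacentSum δ xs
plateausFrom-at []           = refl
plateausFrom-at (x ∷ [])     = refl
plateausFrom-at (x ∷ y ∷ xs) =
  trans (plateausFrom-suc (at (x ∷ y ∷ xs)) (length xs)) (cong (δ x y +_) (plateausFrom-at (y ∷ xs)))

plateausFrom-s′ : ∀ μ → plateausFrom (s′ μ) 0 (ND μ ∸ 1) ≡ countDD μ
plateausFrom-s′ μ = begin
  plateausFrom (s′ μ) 0 (ND μ ∸ 1)                            ≡⟨ plateausFrom-cong 0 (ND μ ∸ 1) (λ _ → s′≗h) ⟩
  plateausFrom (h μ) 0 (ND μ ∸ 1)                             ≡⟨ cong (λ n → plateausFrom (h μ) 0 (n ∸ 1)) (length-heightsFrom 0 μ) ⟨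
  plateausFrom (at (heights μ)) 0 (length (heights μ) ∸ 1)    ≡⟨ plateausFrom-at (heights μ) ⟩
  adjacentSum δ (heights μ)                                   ≡⟨ adjacentSum-δ-heightsFrom 0 μ ⟩
  countDD μ                                                   ∎
  where
  open ≡-Reasoning
  h≤ : ∀ i → h μ i ≤ suc (NU μ)
  h≤ i = m≤n⇒m≤1+n (at-≤ (heightsFrom-≤ 0 μ) i)
  s′≗h : ∀ {m} → δ (s′ μ m) (s′ μ (suc m)) ≡ δ (h μ m) (h μ (suc m))
  s′≗h {m} = δ-cong (∸-cancelˡ-≡ (h≤ m) (h≤ (suc m))) (cong (suc (NU μ) ∸_))

s-≤ : ∀ μ i → s μ i ≤ s′ μ i + countDD μ
s-≤ μ i = begin
  s μ i                                          ≡⟨ algorithm-≡ (ND μ) (s′ μ) i ⟩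
  s′ μ i + plateausFrom (s′ μ) i (ND μ ∸ 1)      ≤⟨ +-monoʳ-≤ (s′ μ i) (plateausFrom-≤ (s′ μ) i (ND μ ∸ 1)) ⟩
  s′ μ i + plateausFrom (s′ μ) 0 (ND μ ∸ 1)      ≡⟨ cong (s′ μ i +_) (plateausFrom-s′ μ) ⟩
  s′ μ i + countDD μ                             ∎
  where open ≤-Reasoning

s-zero : ∀ μ → s μ 0 ≡ s′ μ 0 + countDD μ
s-zero μ = trans (algorithm-≡ (ND μ) (s′ μ) 0) (cong (s′ μ 0 +_) (plateausFrom-s′ μ))

indexFrom : ℕ → ℕ → List ℕ → Maybe ℕ
indexFrom k j []       = nothing
indexFrom k j (x ∷ xs) = if x ≡ᵇ j then just k else indexFrom (suc k) j xs

indexFrom-head : ∀ k x xs → indexFrom k x (x ∷ xs) ≡ just k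
indexFrom-head k x xs rewrite ≡ᵇ-refl x = refl

indexFrom-> : ∀ {k j xs} → All (j <_) xs → indexFrom k j xs ≡ nothing
indexFrom-> []           = refl
indexFrom-> (j<x ∷ j<xs) rewrite ≢⇒≡ᵇ-false (>⇒≢ j<x) = indexFrom-> j<xs

indexFrom-at : ∀ k j xs {i} → indexFrom k j xs ≡ just i → ∃[ m ] i ≡ k + m × at xs m ≡ j
indexFrom-at k j (x ∷ xs) e with x ≡ᵇ j in x≡j
indexFrom-at k j (x ∷ xs) refl | true  = 0 , sym (+-identityʳ k) , ≡ᵇ-true⇒≡ x≡j
indexFrom-at k j (x ∷ xs) e    | false with indexFrom-at (suc k) j xs e
... | m , refl , xs[m]≡j = suc m , sym (+-suc k m) , xs[m]≡j

-- Without a preceding U, a right step at the current height c is not a peak;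
-- hence the hypothesis (c ≡ᵇ j) ≡ false.
mutual
  peaksFrom-U-indexFrom : ∀ i c ν j →
    peakAtHeight (peaksFrom i c (U ∷ ν)) j ≡ indexFrom i j (heightsFrom (suc c) ν)
  peaksFrom-U-indexFrom i c []      j = refl
  peaksFrom-U-indexFrom i c (U ∷ ν) j = peaksFrom-U-indexFrom i (suc c) ν j
  peaksFrom-U-indexFrom i c (D ∷ ν) j with suc c ≡ᵇ j in c≡ᵇj
  ... | true  = refl
  ... | false = peaksFrom-indexFrom (suc i) (suc c) ν j c≡ᵇj

  peaksFrom-indexFrom : ∀ i c ν j → (c ≡ᵇ j) ≡ false →
    peakAtHeight (peaksFrom i c ν) j ≡ indexFrom i j (heightsFrom c ν)
  peaksFrom-indexFrom i c []      j c≢j = refl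
  peaksFrom-indexFrom i c (U ∷ ν) j c≢j = peaksFrom-U-indexFrom i c ν j
  peaksFrom-indexFrom i c (D ∷ ν) j c≢j rewrite c≢j = peaksFrom-indexFrom (suc i) c ν j c≢j

peakAtHeight-peaks : ∀ μ j → peakAtHeight (peaks μ) (suc j) ≡ indexFrom 0 (suc j) (heights μ)
peakAtHeight-peaks μ j = peaksFrom-indexFrom 0 0 μ (suc j) refl

peak-height : ∀ μ {j i} → peakAtHeight (peaks μ) (suc j) ≡ just i → h μ i ≡ suc j
peak-height μ {j} peak with indexFrom-at 0 (suc j) (heights μ) (trans (sym (peakAtHeight-peaks μ j)) peak)
... | m , refl , height = height

yFrom-peak : ∀ μ {j i} d → peakAtHeight (peaks μ) j ≡ just i → yFrom μ j d ≡ suc (s μ i)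
yFrom-peak μ d peak rewrite peak = refl

yFrom-no-peak : ∀ μ {j} d → peakAtHeight (peaks μ) j ≡ nothing → yFrom μ j (suc d) ≡ suc (yFrom μ (suc j) d)
yFrom-no-peak μ d no-peak rewrite no-peak = refl

yFrom-≤ : ∀ μ j d → d ≡ NU μ ∸ suc j → yFrom μ (suc j) d ≤ NU μ ∸ j + suc (countDD μ)
yFrom-≤ μ j d d≡ with peakAtHeight (peaks μ) (suc j) in peak
yFrom-≤ μ j d d≡ | just i = begin
  suc (s μ i)                          ≤⟨ s≤s (s-≤ μ i) ⟩
  suc (suc (NU μ) ∸ h μ i + countDD μ) ≡⟨ cong (λ x → suc (suc (NU μ) ∸ x + countDD μ)) (peak-height μ peak) ⟩
  suc (NU μ ∸ j + countDD μ)           ≡⟨ +-suc (NU μ ∸ j) (countDD μ) ⟨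
  NU μ ∸ j + suc (countDD μ)           ∎
  where open ≤-Reasoning
yFrom-≤ μ j zero    d≡ | nothing = ≤-trans (s≤s z≤n) (m≤n+m (suc (countDD μ)) (NU μ ∸ j))
yFrom-≤ μ j (suc d) d≡ | nothing = begin
  suc (yFrom μ (suc (suc j)) d)           ≤⟨ s≤s (yFrom-≤ μ (suc j) d d≡′) ⟩
  suc (NU μ ∸ suc j) + suc (countDD μ)    ≡⟨ cong (_+ suc (countDD μ)) (+-∸-assoc 1 j<NU) ⟨
  NU μ ∸ j + suc (countDD μ)              ∎
  where
  open ≤-Reasoning
  d≡′ : d ≡ NU μ ∸ suc (suc j)
  d≡′ = trans (cong pred d≡) (pred[m∸n]≡m∸[1+n] (NU μ) (suc j))
  j<NU : j < NU μ
  j<NU = <⇒≤ (m∸n≢0⇒n<m (λ NU∸1+j≡0 → 0≢1+n (trans (sym NU∸1+j≡0) (sym d≡))))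

yFrom-below-first-peak : ∀ μ {a rest} → heights μ ≡ a ∷ rest →
  ∀ j t d → suc (j + t) ≡ a → t ≤ d → yFrom μ (suc j) d ≡ t + suc (s μ 0)
yFrom-below-first-peak μ {a} {rest} hμ j zero d j+0≡a _ = yFrom-peak μ d (begin
  peakAtHeight (peaks μ) (suc j)      ≡⟨ peakAtHeight-peaks μ j ⟩
  indexFrom 0 (suc j) (heights μ)     ≡⟨ cong (indexFrom 0 (suc j)) hμ ⟩
  indexFrom 0 (suc j) (a ∷ rest)      ≡⟨ cong (λ x → indexFrom 0 (suc j) (x ∷ rest)) a≡1+j ⟩
  indexFrom 0 (suc j) (suc j ∷ rest)  ≡⟨ indexFrom-head 0 (suc j) rest ⟩
  just 0                              ∎)
  where
  open ≡-Reasoning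
  a≡1+j : a ≡ suc j
  a≡1+j = trans (sym j+0≡a) (cong suc (+-identityʳ j))
yFrom-below-first-peak μ {a} {rest} hμ j (suc t) (suc d) j+t≡a (s≤s t≤d) =
  trans (yFrom-no-peak μ d no-peak)
        (cong suc (yFrom-below-first-peak μ hμ (suc j) t d (trans (cong suc (sym (+-suc j t))) j+t≡a) t≤d))
  where
  open ≡-Reasoning
  j<a : suc j < a
  j<a = subst (suc j <_) j+t≡a (s≤s (m<m+n j (s≤s z≤n)))
  a≤rest : All (a ≤_) rest
  a≤rest with subst (AllPairs _≤_) hμ (heightsFrom-nondecreasing 0 μ)
  ... | a≤rest ∷ _ = a≤rest
  no-peak : peakAtHeight (peaks μ) (suc j) ≡ nothing
  no-peak = begin
    peakAtHeight (peaks μ) (suc j)  ≡⟨ peakAtHeight-peaks μ j ⟩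
    indexFrom 0 (suc j) (heights μ) ≡⟨ cong (indexFrom 0 (suc j)) hμ ⟩
    indexFrom 0 (suc j) (a ∷ rest)  ≡⟨ indexFrom-> (j<a ∷ All.map (<-≤-trans j<a) a≤rest) ⟩
    nothing                         ∎

y-one : ∀ ν → last (U ∷ ν) ≡ just D → y (U ∷ ν) 1 ≡ suc (NU (U ∷ ν) + countDD (U ∷ ν))
y-one ν lastD with heights (U ∷ ν) in hμ | heightsFrom-≥ 1 ν | heightsFrom-≤ 0 (U ∷ ν)
... | [] | _ | _ = ⊥-elim (0≢1+n (trans (cong length (sym hμ))
                                        (trans (length-heightsFrom 0 (U ∷ ν)) (ND≡1+countDD+countDU (U ∷ ν) lastD))))
... | zero ∷ _ | () ∷ _ | _
... | suc b ∷ rest | _ | b<NU ∷ _ = begin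
  y μ 1                                   ≡⟨ yFrom-below-first-peak μ hμ 0 b (NU μ ∸ 1) refl (∸-monoˡ-≤ 1 b<NU) ⟩
  b + suc (s μ 0)                         ≡⟨ cong (λ x → b + suc x) (s-zero μ) ⟩
  b + suc (suc N ∸ h μ 0 + C)             ≡⟨ cong (λ xs → b + suc (suc N ∸ at xs 0 + C)) hμ ⟩
  b + suc (N ∸ b + C)                     ≡⟨ +-suc b (N ∸ b + C) ⟩
  suc (b + (N ∸ b + C))                   ≡⟨ cong suc (+-assoc b (N ∸ b) C) ⟨
  suc (b + (N ∸ b) + C)                   ≡⟨ cong (λ x → suc (x + C)) (m+[n∸m]≡n (<⇒≤ b<NU)) ⟩
  suc (N + C)                             ∎
  where
  open ≡-Reasoning
  μ = U ∷ ν
  N = NU μ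
  C = countDD μ

M-closed : ∀ ν → last (U ∷ ν) ≡ just D → M (U ∷ ν) ≡ suc (NU (U ∷ ν) + countDD (U ∷ ν))
M-closed ν lastD = begin
  M μ                             ≡⟨⟩
  y μ 1 ⊔ others                  ≡⟨ cong (_⊔ others) (y-one ν lastD) ⟩
  suc (NU μ + countDD μ) ⊔ others ≡⟨ m≥n⇒m⊔n≡m others≤ ⟩
  suc (NU μ + countDD μ)          ∎
  where
  open ≡-Reasoning
  μ = U ∷ ν
  others = foldr _⊔_ 0 (map (y μ ∘ suc) (applyUpTo suc (NU ν)))
  y≤ : ∀ k → y μ (suc k) ≤ suc (NU μ + countDD μ)
  y≤ k = ≤-trans (yFrom-≤ μ k _ refl)
                 (≤-trans (+-monoˡ-≤ _ (m∸n≤m (NU μ) k)) (≤-reflexive (+-suc (NU μ) (countDD μ))))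
  others≤ : others ≤ suc (NU μ + countDD μ)
  others≤ = foldr-preservesᵇ {P = _≤ suc (NU μ + countDD μ)} {f = _⊔_} ⊔-lub z≤n
                             (map⁺ (universal y≤ (applyUpTo suc (NU ν))))

M+countDU≡length : ∀ μ → head μ ≡ just U → last μ ≡ just D → M μ + countDU μ ≡ length μ
M+countDU≡length (U ∷ ν) _ lastD = begin
  M μ + countDU μ                          ≡⟨ cong (_+ countDU μ) (M-closed ν lastD) ⟩
  suc (NU μ + countDD μ) + countDU μ       ≡⟨ cong suc (+-assoc (NU μ) (countDD μ) (countDU μ)) ⟩
  suc (NU μ + (countDD μ + countDU μ))     ≡⟨ +-suc (NU μ) _ ⟨
  NU μ + suc (countDD μ + countDU μ)       ≡⟨ cong (NU μ +_) (ND≡1+countDD+countDU μ lastD) ⟨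
  NU μ + ND μ                              ≡⟨ NU+ND≡length μ ⟩
  length μ                                 ∎
  where
  open ≡-Reasoning
  μ = U ∷ ν

lemma4p3 : (μ : List Step) → head μ ≡ just U → last μ ≡ just D → M μ ≡ M (dual μ)
lemma4p3 μ headU lastD = +-cancelʳ-≡ (countDU μ) (M μ) (M (dual μ)) (begin
  M μ + countDU μ                 ≡⟨ M+countDU≡length μ headU lastD ⟩
  length μ                        ≡⟨ length-dual μ ⟨
  length (dual μ)                 ≡⟨ M+countDU≡length (dual μ) headU′ lastD′ ⟨
  M (dual μ) + countDU (dual μ)   ≡⟨ cong (M (dual μ) +_) (countDU-dual μ) ⟩
  M (dual μ) + countDU μ          ∎)
  where
  open ≡-Reasoning
  headU′ : head (dual μ) ≡ just U
  headU′ = trans (head-dual μ) (cong (Maybe.map dualStep) lastD)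
  lastD′ : last (dual μ) ≡ just D
  lastD′ = trans (last-dual μ) (cong (Maybe.map dualStep) headU)
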